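{- Let $t$ be a non-negative integer and let $\mathcal P$ be the set of all two-coloured Motzkin paths (of any length) starting at $(0,0)$ and ending at height $t$, in which no umber horizontal step occurs at height $0$ and no denim horizontal step occurs before the first down-step. Then $$\sum_{P\in\mathcal P} z^{\#\text{steps}(P)}x^{\#\text{umber}(P)}y^{\#\text{denim}(P)}\alpha^{\#\text{down}(P)}=\left(\frac {z} {1-xz}\right)^t+\frac {\alpha \left(zM(z)\right)^{t+2}}{(1+yzM(z))(1+xzM(z))}+\frac {\alpha zM(z)\left(\left(zM(z)\right)^t-\left(\frac {z} {1-xz}\right)^{t}\right)}{\left(y+\alpha zM(z)\right)\left(1+yzM(z)\right)}.$$
   Context: A two-coloured Motzkin path is a lattice path in $\mathbb Z^2$ consisting of up-steps $(x,y)\to(x+1,y+1)$, down-steps $(x,y)\to(x+1,y-1)$ and horizontal steps $(x,y)\to(x+1,y)$, never going below the $x$-axis (endpoints need not lie on the $x$-axis), where each horizontal step is coloured umber or denim; $\#\text{steps},\#\text{umber},\#\text{denim},\#\text{down}$ denote the numbers of steps, umber horizontal steps, denim horizontal steps and down-steps. $M(z)$ is the unique formal power series in $z$ with coefficients in $\mathbb Z[x,y,\alpha]$ satisfying $M(z)=1+(x+y)zM(z)+\alpha z^2M(z)^2$ (equivalently, the generating function, with the same weights, of two-coloured Motzkin paths from $(0,0)$ ending on the $x$-axis). The identity is one of formal power series in $z$. -}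

module Defs where

open import Data.Nat using (ℕ; zero; suc; _∸_; _≡ᵇ_)
open import Data.Integer using (ℤ; +_; -_) renaming (_+_ to _+ℤ_; _*_ to _*ℤ_)
open import Data.Bool using (Bool; true; false; _∧_; if_then_else_)
open import Data.List using (List; []; _∷_; [_]; map; concatMap; length; filterᵇ)
open import Relation.Binary.PropositionalEquality using (_≡_)

data Step : Set where
  up down umber denim : Step

allSteps : List Step
allSteps = up ∷ down ∷ umber ∷ denim ∷ []

allWords : ℕ → List (List Step)
allWords zero    = [ [] ]
allWords (suc n) = concatMap (λ s → map (s ∷_) (allWords n)) allSteps

inP : ℕ → Bool → ℕ → List Step → Bool
inP h       seen  t []             = h ≡ᵇ t
inP h       seen  t (up    ∷ ps)   = inP (suc h) seen t ps
inP zero    seen  t (down  ∷ ps)   = false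
inP (suc h) seen  t (down  ∷ ps)   = inP h true t ps
inP zero    seen  t (umber ∷ ps)   = false
inP (suc h) seen  t (umber ∷ ps)   = inP (suc h) seen t ps
inP h       false t (denim ∷ ps)   = false
inP h       true  t (denim ∷ ps)   = inP h true t ps

isInP : ℕ → List Step → Bool
isInP t ps = inP 0 false t ps

isStep : Step → Step → Bool
isStep up    up    = true
isStep down  down  = true
isStep umber umber = true
isStep denim denim = true
isStep _     _     = false

count : Step → List Step → ℕ
count s ps = length (filterᵇ (isStep s) ps)

-- A series F is given by its coefficients: F n i j k is the coefficient
-- of z^n x^i y^j α^k.  (We embed ℤ[x,y,α][[z]] into ℤ[[z,x,y,α]];
-- the embedding is an injective ring homomorphism.)

Series : Set
Series = ℕ → ℕ → ℕ → ℕ → ℤ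

infix 4 _≋_
_≋_ : Series → Series → Set
F ≋ G = ∀ n i j k → F n i j k ≡ G n i j k

sumTo : ℕ → (ℕ → ℤ) → ℤ
sumTo zero    f = f zero
sumTo (suc n) f = sumTo n f +ℤ f (suc n)

infixl 6 _⊕_ _⊖_
infixl 7 _⊗_
infixr 8 _^^_

_⊕_ : Series → Series → Series
(F ⊕ G) n i j k = F n i j k +ℤ G n i j k

⊝_ : Series → Series
(⊝ F) n i j k = - F n i j k

_⊖_ : Series → Series → Series
F ⊖ G = F ⊕ (⊝ G)

_⊗_ : Series → Series → Series
(F ⊗ G) n i j k =
  sumTo n λ a → sumTo i λ b → sumTo j λ c → sumTo k λ d →
    F a b c d *ℤ G (n ∸ a) (i ∸ b) (j ∸ c) (k ∸ d)

mono : ℕ → ℕ → ℕ → ℕ → Series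
mono n i j k n' i' j' k' =
  if (n ≡ᵇ n') ∧ (i ≡ᵇ i') ∧ (j ≡ᵇ j') ∧ (k ≡ᵇ k') then + 1 else + 0

𝟙 𝕫 𝕩 𝕪 𝕒 : Series
𝟙 = mono 0 0 0 0
𝕫 = mono 1 0 0 0
𝕩 = mono 0 1 0 0
𝕪 = mono 0 0 1 0
𝕒 = mono 0 0 0 1

_^^_ : Series → ℕ → Series
F ^^ zero  = 𝟙
F ^^ suc m = F ⊗ (F ^^ m)

-- z / (1 - x z) = Σ_{n ≥ 1} x^(n-1) z^n
z/1-xz : Series
z/1-xz zero    i j k = + 0
z/1-xz (suc n) i j k = mono 0 n 0 0 0 i j k

genP : ℕ → Series
genP t n i j k = + length (filterᵇ
  (λ ps → isInP t ps ∧ (count umber ps ≡ᵇ i) ∧ (count denim ps ≡ᵇ j) ∧ (count down ps ≡ᵇ k))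
  (allWords n))

{-# OPTIONS --safe #-}
module Submission where

-- Sort the paths by their final position: the height h and whether a down-step has occurred.
-- Removing the last step expresses the generating function T(b, h) of each position through those
-- of the positions the last step can come from. In this linear system every term except the one
-- of the empty path carries a factor z, so it has only one solution in ℤ[x, y, α][[z]]. With
-- W = zM, g = z/(1 − xz) and D = (1 + yW)(1 + xW)(y + αW), both D·T and the closed forms D·g^h
-- (no down-step yet) and αW^(h+2)(y + αW) + αW(W^h − g^h)(1 + xW) solve the system scaled by D;
-- for the closed forms this is a polynomial identity modulo the equations of W and g and the
-- relation W = g(1 + yW + αW²). The theorem is the sum over the two positions at height t.

open import Defs
open import Algebra.Bundles using (CommutativeRing; RawRing)
open import Algebra.Core using (Op₁; Op₂)
import Algebra.Consequences.Setoid as Consequences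
import Algebra.Construct.Pointwise as Pointwise
import Algebra.Morphism.Construct.Composition as Compose
import Algebra.Morphism.RingMonomorphism as RingMonomorphism
open import Algebra.Morphism.Structures using (IsRingHomomorphism; IsRingMonomorphism)
import Algebra.Solver.Ring
open import Algebra.Solver.Ring.AlmostCommutativeRing using (fromCommutativeRing; _-Raw-AlmostCommutative⟶_)
open import Algebra.Structures using (IsCommutativeRing)
open import Data.Bool using (Bool; true; false; _∧_; _∨_; if_then_else_; T?)
import Data.Bool.Properties as Bool
open import Data.Bool.Properties using (∧-zeroʳ; ∧-distribʳ-∨)
open import Data.Integer using (ℤ; +_) renaming (_+_ to _+ℤ_; _*_ to _*ℤ_; -_ to -ℤ_)
import Data.Integer.Properties as ℤ
open import Data.List using (List; []; _∷_; [_]; _++_; _∷ʳ_; map; concatMap; length; filterᵇ; foldl)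
open import Data.List.Properties using (filter-++; length-++; map-cong; foldl-∷ʳ)
open import Data.Maybe using (Maybe; just; nothing)
import Data.Maybe as Maybe
open import Data.Nat using (ℕ; zero; suc; _∸_; _≤_; _<_; z≤n; s≤s; _≡ᵇ_) renaming (_+_ to _+ℕ_)
open import Data.Nat.ListAction using (sum)
import Data.Nat.Properties as ℕ
open import Data.Nat.Properties using (≤-refl; m≤n⇒m≤1+n; m∸[m∸n]≡n; m+n∸m≡n; ∸-+-assoc; m∸n≤m; ≤-<-trans; n<1+n)
open import Data.Product using (_×_; _,_)
open import Data.Unit using (⊤; tt)
open import Function using (id; _∘_)
open import Level using (0ℓ)
open import Relation.Binary.Bundles using (Setoid)
open import Relation.Binary.Core using (Rel)
open import Relation.Binary.PropositionalEquality as ≡ using (_≡_)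
import Relation.Binary.Reasoning.Setoid
open import Relation.Nullary.Decidable using (does; dec⇒maybe)

-- Power series over a commutative ring

sumUpTo : ∀ {a} {A : Set a} → Op₂ A → ℕ → (ℕ → A) → A
sumUpTo _∙_ zero    f = f zero
sumUpTo _∙_ (suc n) f = sumUpTo _∙_ n f ∙ f (suc n)

sumUpTo-cong : ∀ {a} {A : Set a} (_∙_ : Op₂ A) n {f g : ℕ → A} →
               (∀ i → f i ≡ g i) → sumUpTo _∙_ n f ≡ sumUpTo _∙_ n g
sumUpTo-cong _∙_ zero    f≡g = f≡g 0
sumUpTo-cong _∙_ (suc n) f≡g = ≡.cong₂ _∙_ (sumUpTo-cong _∙_ n f≡g) (f≡g (suc n))

sumUpTo-apply : ∀ {a b} {A : Set a} {B : Set b} (_∙_ : Op₂ B) n (f : ℕ → A → B) x →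
                sumUpTo (λ g h y → g y ∙ h y) n f x ≡ sumUpTo _∙_ n (λ i → f i x)
sumUpTo-apply _∙_ zero    f x = ≡.refl
sumUpTo-apply _∙_ (suc n) f x = ≡.cong (_∙ f (suc n) x) (sumUpTo-apply _∙_ n f x)

module PowerSeries {c ℓ} (R : CommutativeRing c ℓ) where

  open CommutativeRing R hiding (zero; isCommutativeRing)
  open import Relation.Binary.Reasoning.Setoid setoid
  open import Algebra.Properties.CommutativeSemigroup +-commutativeSemigroup using (interchange)
  open import Algebra.Properties.Ring ring using (-0#≈0#)

  infix  4 _≐_
  infixl 6 _+ᵖ_
  infixl 7 _*ᵖ_

  Ser : Set c
  Ser = ℕ → Carrier

  _≐_ : Rel Ser ℓ
  F ≐ G = ∀ n → F n ≈ G n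

  _+ᵖ_ : Op₂ Ser
  (F +ᵖ G) n = F n + G n

  -ᵖ_ : Op₁ Ser
  (-ᵖ F) n = - F n

  0ᵖ : Ser
  0ᵖ _ = 0#

  C : Carrier → Ser
  C a zero    = a
  C a (suc n) = 0#

  1ᵖ : Ser
  1ᵖ = C 1#

  X : Ser
  X zero    = 0#
  X (suc n) = 1ᵖ n

  Σ≤ : ℕ → (ℕ → Carrier) → Carrier
  Σ≤ = sumUpTo _+_

  _*ᵖ_ : Op₂ Ser
  (F *ᵖ G) n = Σ≤ n λ a → F a * G (n ∸ a)

  Σ≤-cong : ∀ n {f g} → (∀ a → a ≤ n → f a ≈ g a) → Σ≤ n f ≈ Σ≤ n g
  Σ≤-cong zero    f≈g = f≈g 0 z≤n
  Σ≤-cong (suc n) f≈g = +-cong (Σ≤-cong n λ a a≤n → f≈g a (m≤n⇒m≤1+n a≤n)) (f≈g (suc n) ≤-refl)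

  Σ≤-+ : ∀ n f g → Σ≤ n (λ a → f a + g a) ≈ Σ≤ n f + Σ≤ n g
  Σ≤-+ zero    f g = refl
  Σ≤-+ (suc n) f g = trans (+-congʳ (Σ≤-+ n f g)) (interchange _ _ _ _)

  *-Σ≤ : ∀ n k f → k * Σ≤ n f ≈ Σ≤ n (λ a → k * f a)
  *-Σ≤ zero    k f = refl
  *-Σ≤ (suc n) k f = trans (distribˡ k _ _) (+-congʳ (*-Σ≤ n k f))

  Σ≤-* : ∀ n k f → Σ≤ n f * k ≈ Σ≤ n (λ a → f a * k)
  Σ≤-* zero    k f = refl
  Σ≤-* (suc n) k f = trans (distribʳ k _ _) (+-congʳ (Σ≤-* n k f))

  Σ≤-0# : ∀ n {f} → (∀ a → f a ≈ 0#) → Σ≤ n f ≈ 0#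
  Σ≤-0# zero    f≈0 = f≈0 0
  Σ≤-0# (suc n) f≈0 = trans (+-cong (Σ≤-0# n f≈0) (f≈0 (suc n))) (+-identityʳ 0#)

  Σ≤-suc : ∀ n f → Σ≤ (suc n) f ≈ f 0 + Σ≤ n (λ a → f (suc a))
  Σ≤-suc zero    f = refl
  Σ≤-suc (suc n) f = trans (+-congʳ (Σ≤-suc n f)) (+-assoc _ _ _)

  Σ≤-reverse : ∀ n f → Σ≤ n f ≈ Σ≤ n (λ a → f (n ∸ a))
  Σ≤-reverse zero    f = refl
  Σ≤-reverse (suc n) f = begin
    Σ≤ n f + f (suc n)                  ≈⟨ +-congʳ (Σ≤-reverse n f) ⟩
    Σ≤ n (λ a → f (n ∸ a)) + f (suc n)  ≈⟨ +-comm _ _ ⟩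
    f (suc n) + Σ≤ n (λ a → f (n ∸ a))  ≈⟨ Σ≤-suc n (λ a → f (suc n ∸ a)) ⟨
    Σ≤ (suc n) (λ a → f (suc n ∸ a))    ∎

  Σ≤-triangle : ∀ n (φ : ℕ → ℕ → Carrier) →
                Σ≤ n (λ a → Σ≤ a (φ a)) ≈ Σ≤ n (λ b → Σ≤ (n ∸ b) (λ d → φ (b +ℕ d) b))
  Σ≤-triangle zero    φ = refl
  Σ≤-triangle (suc n) φ = begin
    Σ≤ (suc n) (λ a → Σ≤ a (φ a))
      ≈⟨ Σ≤-suc n _ ⟩
    φ 0 0 + Σ≤ n (λ a → Σ≤ (suc a) (φ (suc a)))
      ≈⟨ +-congˡ (Σ≤-cong n λ a _ → Σ≤-suc a (φ (suc a))) ⟩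
    φ 0 0 + Σ≤ n (λ a → φ (suc a) 0 + Σ≤ a (λ b → φ (suc a) (suc b)))
      ≈⟨ +-congˡ (Σ≤-+ n _ _) ⟩
    φ 0 0 + (Σ≤ n (λ a → φ (suc a) 0) + Σ≤ n (λ a → Σ≤ a (λ b → φ (suc a) (suc b))))
      ≈⟨ +-assoc _ _ _ ⟨
    (φ 0 0 + Σ≤ n (λ a → φ (suc a) 0)) + Σ≤ n (λ a → Σ≤ a (λ b → φ (suc a) (suc b)))
      ≈⟨ +-cong (sym (Σ≤-suc n _)) (Σ≤-triangle n λ a b → φ (suc a) (suc b)) ⟩
    Σ≤ (suc n) (λ d → φ d 0) + Σ≤ n (λ b → Σ≤ (n ∸ b) (λ d → φ (suc b +ℕ d) (suc b)))
      ≈⟨ Σ≤-suc n _ ⟨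
    Σ≤ (suc n) (λ b → Σ≤ (suc n ∸ b) (λ d → φ (b +ℕ d) b)) ∎

  C*-coeff : ∀ a F → C a *ᵖ F ≐ λ n → a * F n
  C*-coeff a F zero    = refl
  C*-coeff a F (suc n) = begin
    Σ≤ (suc n) (λ b → C a b * F (suc n ∸ b))    ≈⟨ Σ≤-suc n _ ⟩
    a * F (suc n) + Σ≤ n (λ b → 0# * F (n ∸ b)) ≈⟨ +-congˡ (Σ≤-0# n λ b → zeroˡ _) ⟩
    a * F (suc n) + 0#                          ≈⟨ +-identityʳ _ ⟩
    a * F (suc n)                               ∎

  X*-coeff-zero : ∀ F → (X *ᵖ F) 0 ≈ 0#
  X*-coeff-zero F = zeroˡ (F 0)

  X*-coeff-suc : ∀ F n → (X *ᵖ F) (suc n) ≈ F n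
  X*-coeff-suc F n = begin
    Σ≤ (suc n) (λ a → X a * F (suc n ∸ a))  ≈⟨ Σ≤-suc n _ ⟩
    0# * F (suc n) + (1ᵖ *ᵖ F) n            ≈⟨ +-cong (zeroˡ _) (C*-coeff 1# F n) ⟩
    0# + 1# * F n                           ≈⟨ +-identityˡ _ ⟩
    1# * F n                                ≈⟨ *-identityˡ _ ⟩
    F n                                     ∎

  *ᵖ-cong : ∀ {F F′ G G′} → F ≐ F′ → G ≐ G′ → F *ᵖ G ≐ F′ *ᵖ G′
  *ᵖ-cong F≐F′ G≐G′ n = Σ≤-cong n λ a _ → *-cong (F≐F′ a) (G≐G′ (n ∸ a))

  *ᵖ-comm : ∀ F G → F *ᵖ G ≐ G *ᵖ F
  *ᵖ-comm F G n = begin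
    Σ≤ n (λ a → F a * G (n ∸ a))              ≈⟨ Σ≤-reverse n _ ⟩
    Σ≤ n (λ a → F (n ∸ a) * G (n ∸ (n ∸ a)))  ≈⟨ Σ≤-cong n (λ a a≤n →
                                                   trans (*-comm _ _) (*-congʳ (reflexive (≡.cong G (m∸[m∸n]≡n a≤n))))) ⟩
    Σ≤ n (λ a → G a * F (n ∸ a))              ∎

  *ᵖ-assoc : ∀ F G H → (F *ᵖ G) *ᵖ H ≐ F *ᵖ (G *ᵖ H)
  *ᵖ-assoc F G H n = begin
    Σ≤ n (λ a → Σ≤ a (λ b → F b * G (a ∸ b)) * H (n ∸ a))
      ≈⟨ Σ≤-cong n (λ a _ → Σ≤-* a _ _) ⟩
    Σ≤ n (λ a → Σ≤ a (λ b → F b * G (a ∸ b) * H (n ∸ a)))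
      ≈⟨ Σ≤-triangle n _ ⟩
    Σ≤ n (λ b → Σ≤ (n ∸ b) (λ d → F b * G (b +ℕ d ∸ b) * H (n ∸ (b +ℕ d))))
      ≈⟨ Σ≤-cong n (λ b _ → Σ≤-cong (n ∸ b) λ d _ → trans (*-assoc _ _ _) (*-congˡ (*-cong
           (reflexive (≡.cong G (m+n∸m≡n b d))) (reflexive (≡.cong H (≡.sym (∸-+-assoc n b d))))))) ⟩
    Σ≤ n (λ b → Σ≤ (n ∸ b) (λ d → F b * (G d * H (n ∸ b ∸ d))))
      ≈⟨ Σ≤-cong n (λ b _ → *-Σ≤ (n ∸ b) _ _) ⟨
    Σ≤ n (λ b → F b * Σ≤ (n ∸ b) (λ d → G d * H (n ∸ b ∸ d))) ∎

  *ᵖ-identityˡ : ∀ F → 1ᵖ *ᵖ F ≐ F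
  *ᵖ-identityˡ F n = trans (C*-coeff 1# F n) (*-identityˡ (F n))

  *ᵖ-distribˡ : ∀ F G H → F *ᵖ (G +ᵖ H) ≐ F *ᵖ G +ᵖ F *ᵖ H
  *ᵖ-distribˡ F G H n = trans (Σ≤-cong n λ a _ → distribˡ _ _ _) (Σ≤-+ n _ _)

  ≐-setoid : Setoid c ℓ
  ≐-setoid = record { isEquivalence = Pointwise.isEquivalence ℕ isEquivalence }

  isCommutativeRing : IsCommutativeRing _≐_ _+ᵖ_ _*ᵖ_ -ᵖ_ 0ᵖ 1ᵖ
  isCommutativeRing = record
    { isRing = record
      { +-isAbelianGroup = Pointwise.isAbelianGroup ℕ +-isAbelianGroup
      ; *-cong           = *ᵖ-cong
      ; *-assoc          = *ᵖ-assoc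
      ; *-identity       = comm∧idˡ⇒id *ᵖ-comm *ᵖ-identityˡ
      ; distrib          = comm∧distrˡ⇒distr +ᵖ-cong *ᵖ-comm *ᵖ-distribˡ
      }
    ; *-comm = *ᵖ-comm
    }
    where
    open Consequences ≐-setoid
    +ᵖ-cong : ∀ {F F′ G G′} → F ≐ F′ → G ≐ G′ → F +ᵖ G ≐ F′ +ᵖ G′
    +ᵖ-cong F≐F′ G≐G′ n = +-cong (F≐F′ n) (G≐G′ n)

  commutativeRing : CommutativeRing c ℓ
  commutativeRing = record { isCommutativeRing = isCommutativeRing }

  C-isRingHomomorphism : IsRingHomomorphism rawRing (CommutativeRing.rawRing commutativeRing) C
  C-isRingHomomorphism = record
    { isSemiringHomomorphism = record
      { isNearSemiringHomomorphism = record
        { +-isMonoidHomomorphism = record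
          { isMagmaHomomorphism = record
            { isRelHomomorphism = record { cong = C-cong }
            ; homo = C-+ }
          ; ε-homo = C-0# }
        ; *-homo = C-* }
      ; 1#-homo = λ _ → refl }
    ; -‿homo = C-- }
    where
    C-cong : ∀ {a b} → a ≈ b → C a ≐ C b
    C-cong a≈b zero    = a≈b
    C-cong a≈b (suc n) = refl
    C-+ : ∀ a b → C (a + b) ≐ C a +ᵖ C b
    C-+ a b zero    = refl
    C-+ a b (suc n) = sym (+-identityʳ 0#)
    C-0# : C 0# ≐ 0ᵖ
    C-0# zero    = refl
    C-0# (suc n) = refl
    C-* : ∀ a b → C (a * b) ≐ C a *ᵖ C b
    C-* a b zero    = refl
    C-* a b (suc n) = sym (trans (C*-coeff a (C b) (suc n)) (zeroʳ a))
    C-- : ∀ a → C (- a) ≐ -ᵖ C a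
    C-- a zero    = refl
    C-- a (suc n) = sym -0#≈0#

-- Series as a commutative ring

-- Inside PowerSeries, _+_ is the ring addition; from here on it is addition on ℕ.
open import Data.Nat using (_+_)

-- Series is ℤ⟦α⟧⟦y⟧⟦x⟧⟦z⟧ (the first index is the exponent of z); its ring structure is pulled
-- back from the iterated power series ring along the identity map.
module ℤ⟦α⟧ = PowerSeries ℤ.+-*-commutativeRing
module ℤ⟦yα⟧ = PowerSeries ℤ⟦α⟧.commutativeRing
module ℤ⟦xyα⟧ = PowerSeries ℤ⟦yα⟧.commutativeRing
module ℤ⟦zxyα⟧ = PowerSeries ℤ⟦xyα⟧.commutativeRing

sumTo≡sumUpTo : ∀ n f → sumTo n f ≡ sumUpTo _+ℤ_ n f
sumTo≡sumUpTo zero    f = ≡.refl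
sumTo≡sumUpTo (suc n) f = ≡.cong (_+ℤ f (suc n)) (sumTo≡sumUpTo n f)

⊗≋*ᵖ : ∀ F G → F ⊗ G ≋ F ℤ⟦zxyα⟧.*ᵖ G
⊗≋*ᵖ F G n i j k = begin
  (F ⊗ G) n i j k
    ≡⟨ sumTo≡sumUpTo n _ ⟩
  sumUpTo _+ℤ_ n (λ a → sumTo i λ b → sumTo j λ c → sumTo k λ d →
    F a b c d *ℤ G (n ∸ a) (i ∸ b) (j ∸ c) (k ∸ d))
    ≡⟨ sumUpTo-cong _+ℤ_ n (λ a → ≡.trans (sumTo≡sumUpTo i _) (sumUpTo-cong _+ℤ_ i λ b →
         ≡.trans (sumTo≡sumUpTo j _) (sumUpTo-cong _+ℤ_ j λ c → sumTo≡sumUpTo k _))) ⟩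
  sumUpTo _+ℤ_ n (λ a → sumUpTo _+ℤ_ i λ b → sumUpTo _+ℤ_ j λ c → sumUpTo _+ℤ_ k λ d →
    F a b c d *ℤ G (n ∸ a) (i ∸ b) (j ∸ c) (k ∸ d))
    ≡⟨ sumUpTo-cong _+ℤ_ n (λ a → ≡.trans (apply₂ i _ j k) (sumUpTo-cong _+ℤ_ i λ b → sumUpTo-apply _+ℤ_ j _ k)) ⟨
  sumUpTo _+ℤ_ n (λ a → (F a ℤ⟦xyα⟧.*ᵖ G (n ∸ a)) i j k)
    ≡⟨ apply₃ n _ i j k ⟨
  (F ℤ⟦zxyα⟧.*ᵖ G) n i j k ∎
  where
  open ≡.≡-Reasoning
  apply₂ : ∀ n (f : ℕ → ℕ → ℕ → ℤ) j k → sumUpTo ℤ⟦yα⟧._+ᵖ_ n f j k ≡ sumUpTo _+ℤ_ n (λ a → f a j k)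
  apply₂ n f j k = ≡.trans (≡.cong (λ h → h k) (sumUpTo-apply ℤ⟦α⟧._+ᵖ_ n f j)) (sumUpTo-apply _+ℤ_ n _ k)
  apply₃ : ∀ n (f : ℕ → ℕ → ℕ → ℕ → ℤ) i j k → sumUpTo ℤ⟦xyα⟧._+ᵖ_ n f i j k ≡ sumUpTo _+ℤ_ n (λ a → f a i j k)
  apply₃ n f i j k = ≡.trans (≡.cong (λ h → h j k) (sumUpTo-apply ℤ⟦yα⟧._+ᵖ_ n f i)) (apply₂ n _ j k)

C⁴ : ℤ → Series
C⁴ c = ℤ⟦zxyα⟧.C (ℤ⟦xyα⟧.C (ℤ⟦yα⟧.C (ℤ⟦α⟧.C c)))

C⁴-isRingHomomorphism : IsRingHomomorphism (CommutativeRing.rawRing ℤ.+-*-commutativeRing)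
                                           (CommutativeRing.rawRing ℤ⟦zxyα⟧.commutativeRing) C⁴
C⁴-isRingHomomorphism =
  Compose.isRingHomomorphism (CommutativeRing.trans ℤ⟦zxyα⟧.commutativeRing)
    (Compose.isRingHomomorphism (CommutativeRing.trans ℤ⟦xyα⟧.commutativeRing)
      (Compose.isRingHomomorphism (CommutativeRing.trans ℤ⟦yα⟧.commutativeRing)
        ℤ⟦α⟧.C-isRingHomomorphism ℤ⟦yα⟧.C-isRingHomomorphism)
      ℤ⟦xyα⟧.C-isRingHomomorphism)
    ℤ⟦zxyα⟧.C-isRingHomomorphism

-- Written like 𝟙 = mono 0 0 0 0, so that κ (+ 1) is 𝟙 and κ (+ 0) is 𝟘 definitionally: the ring
-- solver, whose constants are evaluated by κ, then states its equations with 𝟙 and 𝟘 literally.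
κ : ℤ → Series
κ c n i j k = if (0 ≡ᵇ n) ∧ (0 ≡ᵇ i) ∧ (0 ≡ᵇ j) ∧ (0 ≡ᵇ k) then c else + 0

𝟘 : Series
𝟘 = κ (+ 0)

κ≋C⁴ : ∀ c → κ c ≋ C⁴ c
κ≋C⁴ c zero    zero    zero    zero    = ≡.refl
κ≋C⁴ c zero    zero    zero    (suc k) = ≡.refl
κ≋C⁴ c zero    zero    (suc j) k       = ≡.refl
κ≋C⁴ c zero    (suc i) j       k       = ≡.refl
κ≋C⁴ c (suc n) i       j       k       = ≡.refl

𝟘-coeff : 𝟘 ≋ λ _ _ _ _ → + 0
𝟘-coeff n i j k = ≡.trans (κ≋C⁴ (+ 0) n i j k) (IsRingHomomorphism.0#-homo C⁴-isRingHomomorphism n i j k)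

-- A record rather than _≋_ itself, so that unification can read off the two series of an equation.
infix 4 _≈_
record _≈_ (F G : Series) : Set where
  constructor ≋⇒≈
  field ≈⇒≋ : F ≋ G
open _≈_ public

seriesRawRing : RawRing 0ℓ 0ℓ
seriesRawRing = record
  { Carrier = Series ; _≈_ = _≈_ ; _+_ = _⊕_ ; _*_ = _⊗_ ; -_ = ⊝_ ; 0# = 𝟘 ; 1# = 𝟙 }

id-isRingMonomorphism : IsRingMonomorphism seriesRawRing (CommutativeRing.rawRing ℤ⟦zxyα⟧.commutativeRing) id
id-isRingMonomorphism = record
  { isRingHomomorphism = record
    { isSemiringHomomorphism = record
      { isNearSemiringHomomorphism = record
        { +-isMonoidHomomorphism = record
          { isMagmaHomomorphism = record
            { isRelHomomorphism = record { cong = ≈⇒≋ }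
            ; homo = λ _ _ _ _ _ _ → ≡.refl }
          ; ε-homo = 𝟘-coeff }
        ; *-homo = ⊗≋*ᵖ }
      ; 1#-homo = κ≋C⁴ (+ 1) }
    ; -‿homo = λ _ _ _ _ _ → ≡.refl }
  ; injective = ≋⇒≈
  }

seriesRing : CommutativeRing 0ℓ 0ℓ
seriesRing = record
  { isCommutativeRing = RingMonomorphism.isCommutativeRing id-isRingMonomorphism ℤ⟦zxyα⟧.isCommutativeRing }

κ-morphism : CommutativeRing.rawRing ℤ.+-*-commutativeRing -Raw-AlmostCommutative⟶ fromCommutativeRing seriesRing
κ-morphism = record
  { ⟦_⟧    = κ
  ; +-homo = λ a b → via (κ≋C⁴ (a +ℤ b)) (C⁴.+-homo a b) λ n i j k →
                       ≡.cong₂ _+ℤ_ (κ≋C⁴ a n i j k) (κ≋C⁴ b n i j k)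
  ; *-homo = λ a b → via (κ≋C⁴ (a *ℤ b)) (C⁴.*-homo a b) λ n i j k →
                       ≡.trans (⊗≋*ᵖ (κ a) (κ b) n i j k) (ℤ⟦zxyα⟧.*ᵖ-cong (κ≋C⁴ a) (κ≋C⁴ b) n i j k)
  ; -‿homo = λ a → via (κ≋C⁴ (-ℤ a)) (C⁴.-‿homo a) λ n i j k → ≡.cong -ℤ_ (κ≋C⁴ a n i j k)
  ; 0-homo = ≋⇒≈ λ _ _ _ _ → ≡.refl
  ; 1-homo = ≋⇒≈ λ _ _ _ _ → ≡.refl
  }
  where
  module C⁴ = IsRingHomomorphism C⁴-isRingHomomorphism
  via : ∀ {F F′ G G′} → F ≋ F′ → F′ ≋ G′ → G ≋ G′ → F ≈ G
  via F≋F′ F′≋G′ G≋G′ = ≋⇒≈ λ n i j k →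
    ≡.trans (F≋F′ n i j k) (≡.trans (F′≋G′ n i j k) (≡.sym (G≋G′ n i j k)))

module SeriesSolver = Algebra.Solver.Ring (CommutativeRing.rawRing ℤ.+-*-commutativeRing)
  (fromCommutativeRing seriesRing) κ-morphism
  (λ a b → Maybe.map (λ a≡b → ≋⇒≈ λ n i j k → ≡.cong (λ c → κ c n i j k) a≡b) (dec⇒maybe (a ℤ.≟ b)))

open CommutativeRing seriesRing
  using (refl; trans; +-cong; +-congˡ; *-congˡ; *-congʳ; +-assoc; zeroˡ; distribʳ)
open SeriesSolver using (solve; _:=_; _:+_; _:*_; _:-_; :-_; con; Polynomial)
module ≈-Reasoning = Relation.Binary.Reasoning.Setoid (CommutativeRing.setoid seriesRing)

-- Coefficients, and uniqueness of z-adic fixed points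

𝕫≋X : 𝕫 ≋ ℤ⟦zxyα⟧.X
𝕫≋X zero          i       j       k       = ≡.refl
𝕫≋X (suc zero)    zero    zero    zero    = ≡.refl
𝕫≋X (suc zero)    zero    zero    (suc k) = ≡.refl
𝕫≋X (suc zero)    zero    (suc j) k       = ≡.refl
𝕫≋X (suc zero)    (suc i) j       k       = ≡.refl
𝕫≋X (suc (suc n)) i       j       k       = ≡.refl

𝕩≋CX : 𝕩 ≋ ℤ⟦zxyα⟧.C ℤ⟦xyα⟧.X
𝕩≋CX zero    zero          j       k       = ≡.refl
𝕩≋CX zero    (suc zero)    zero    zero    = ≡.refl
𝕩≋CX zero    (suc zero)    zero    (suc k) = ≡.refl
𝕩≋CX zero    (suc zero)    (suc j) k       = ≡.refl
𝕩≋CX zero    (suc (suc i)) j       k       = ≡.refl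
𝕩≋CX (suc n) i             j       k       = ≡.refl

𝕪≋CCX : 𝕪 ≋ ℤ⟦zxyα⟧.C (ℤ⟦xyα⟧.C ℤ⟦yα⟧.X)
𝕪≋CCX zero    zero    zero          k       = ≡.refl
𝕪≋CCX zero    zero    (suc zero)    zero    = ≡.refl
𝕪≋CCX zero    zero    (suc zero)    (suc k) = ≡.refl
𝕪≋CCX zero    zero    (suc (suc j)) k       = ≡.refl
𝕪≋CCX zero    (suc i) j             k       = ≡.refl
𝕪≋CCX (suc n) i       j             k       = ≡.refl

𝕒≋CCCX : 𝕒 ≋ ℤ⟦zxyα⟧.C (ℤ⟦xyα⟧.C (ℤ⟦yα⟧.C ℤ⟦α⟧.X))
𝕒≋CCCX zero    zero    zero    zero          = ≡.refl
𝕒≋CCCX zero    zero    zero    (suc zero)    = ≡.refl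
𝕒≋CCCX zero    zero    zero    (suc (suc k)) = ≡.refl
𝕒≋CCCX zero    zero    (suc j) k             = ≡.refl
𝕒≋CCCX zero    (suc i) j       k             = ≡.refl
𝕒≋CCCX (suc n) i       j       k             = ≡.refl

module _ (F : Series) where

  private
    via : ∀ {m m′} → m ≋ m′ → m ⊗ F ≋ m′ ℤ⟦zxyα⟧.*ᵖ F
    via {m} {m′} m≋m′ n i j k =
      ≡.trans (⊗≋*ᵖ m F n i j k) (ℤ⟦zxyα⟧.*ᵖ-cong {m} {m′} {F} {F} m≋m′ (λ _ _ _ _ → ≡.refl) n i j k)

  𝕫⊗-coeff-zero : ∀ i j k → (𝕫 ⊗ F) 0 i j k ≡ + 0
  𝕫⊗-coeff-zero i j k = ≡.trans (via 𝕫≋X 0 i j k) (ℤ⟦zxyα⟧.X*-coeff-zero F i j k)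

  𝕫⊗-coeff-suc : ∀ n i j k → (𝕫 ⊗ F) (suc n) i j k ≡ F n i j k
  𝕫⊗-coeff-suc n i j k = ≡.trans (via 𝕫≋X (suc n) i j k) (ℤ⟦zxyα⟧.X*-coeff-suc F n i j k)

  𝕩⊗-coeff-zero : ∀ n j k → (𝕩 ⊗ F) n 0 j k ≡ + 0
  𝕩⊗-coeff-zero n j k = ≡.trans (via 𝕩≋CX n 0 j k)
    (≡.trans (ℤ⟦zxyα⟧.C*-coeff _ F n 0 j k) (ℤ⟦xyα⟧.X*-coeff-zero (F n) j k))

  𝕩⊗-coeff-suc : ∀ n i j k → (𝕩 ⊗ F) n (suc i) j k ≡ F n i j k
  𝕩⊗-coeff-suc n i j k = ≡.trans (via 𝕩≋CX n (suc i) j k)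
    (≡.trans (ℤ⟦zxyα⟧.C*-coeff _ F n (suc i) j k) (ℤ⟦xyα⟧.X*-coeff-suc (F n) i j k))

  𝕪⊗-coeff-zero : ∀ n i k → (𝕪 ⊗ F) n i 0 k ≡ + 0
  𝕪⊗-coeff-zero n i k = ≡.trans (via 𝕪≋CCX n i 0 k)
    (≡.trans (ℤ⟦zxyα⟧.C*-coeff _ F n i 0 k)
      (≡.trans (ℤ⟦xyα⟧.C*-coeff _ (F n) i 0 k) (ℤ⟦yα⟧.X*-coeff-zero (F n i) k)))

  𝕪⊗-coeff-suc : ∀ n i j k → (𝕪 ⊗ F) n i (suc j) k ≡ F n i j k
  𝕪⊗-coeff-suc n i j k = ≡.trans (via 𝕪≋CCX n i (suc j) k)
    (≡.trans (ℤ⟦zxyα⟧.C*-coeff _ F n i (suc j) k)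
      (≡.trans (ℤ⟦xyα⟧.C*-coeff _ (F n) i (suc j) k) (ℤ⟦yα⟧.X*-coeff-suc (F n i) j k)))

  𝕒⊗-coeff-zero : ∀ n i j → (𝕒 ⊗ F) n i j 0 ≡ + 0
  𝕒⊗-coeff-zero n i j = ≡.trans (via 𝕒≋CCCX n i j 0)
    (≡.trans (ℤ⟦zxyα⟧.C*-coeff _ F n i j 0)
      (≡.trans (ℤ⟦xyα⟧.C*-coeff _ (F n) i j 0)
        (≡.trans (ℤ⟦yα⟧.C*-coeff _ (F n i) j 0) (ℤ⟦α⟧.X*-coeff-zero (F n i j)))))

  𝕒⊗-coeff-suc : ∀ n i j k → (𝕒 ⊗ F) n i j (suc k) ≡ F n i j k
  𝕒⊗-coeff-suc n i j k = ≡.trans (via 𝕒≋CCCX n i j (suc k))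
    (≡.trans (ℤ⟦zxyα⟧.C*-coeff _ F n i j (suc k))
      (≡.trans (ℤ⟦xyα⟧.C*-coeff _ (F n) i j (suc k))
        (≡.trans (ℤ⟦yα⟧.C*-coeff _ (F n i) j (suc k)) (ℤ⟦α⟧.X*-coeff-suc (F n i j) k))))

infix 4 _≋[<_]_
_≋[<_]_ : Series → ℕ → Series → Set
F ≋[< n ] G = ∀ m → m < n → ∀ i j k → F m i j k ≡ G m i j k

⊕-cong-< : ∀ {n F F′ G G′} → F ≋[< n ] F′ → G ≋[< n ] G′ → F ⊕ G ≋[< n ] F′ ⊕ G′
⊕-cong-< F≋F′ G≋G′ m m<n i j k = ≡.cong₂ _+ℤ_ (F≋F′ m m<n i j k) (G≋G′ m m<n i j k)

⊗-congˡ-< : ∀ {n} F {G G′} → G ≋[< n ] G′ → F ⊗ G ≋[< n ] F ⊗ G′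
⊗-congˡ-< F G≋G′ m m<n i j k =
  sumTo-cong m λ a → sumTo-cong i λ b → sumTo-cong j λ c → sumTo-cong k λ d →
    ≡.cong (F a b c d *ℤ_) (G≋G′ (m ∸ a) (≤-<-trans (m∸n≤m m a) m<n) (i ∸ b) (j ∸ c) (k ∸ d))
  where
  sumTo-cong : ∀ n {f g} → (∀ a → f a ≡ g a) → sumTo n f ≡ sumTo n g
  sumTo-cong n f≡g =
    ≡.trans (sumTo≡sumUpTo n _) (≡.trans (sumUpTo-cong _+ℤ_ n f≡g) (≡.sym (sumTo≡sumUpTo n _)))

𝕫⊗-cong-< : ∀ {n F G} → F ≋[< n ] G → 𝕫 ⊗ F ≋[< suc n ] 𝕫 ⊗ G
𝕫⊗-cong-< {F = F} {G} F≋G zero    _         i j k =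
  ≡.trans (𝕫⊗-coeff-zero F i j k) (≡.sym (𝕫⊗-coeff-zero G i j k))
𝕫⊗-cong-< {F = F} {G} F≋G (suc m) (s≤s m<n) i j k =
  ≡.trans (𝕫⊗-coeff-suc F m i j k) (≡.trans (F≋G m m<n i j k) (≡.sym (𝕫⊗-coeff-suc G m i j k)))

module _ {I : Set} (Φ : (I → Series) → I → Series)
         (Φ-causal : ∀ n {F G : I → Series} → (∀ ι → F ι ≋[< n ] G ι) → ∀ ι → Φ F ι ≋[< n ] Φ G ι) where

  unique-fixpoint : ∀ {B F G : I → Series} →
                    (∀ ι → F ι ≈ B ι ⊕ 𝕫 ⊗ Φ F ι) → (∀ ι → G ι ≈ B ι ⊕ 𝕫 ⊗ Φ G ι) → ∀ ι → F ι ≈ G ι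
  unique-fixpoint {B} {F} {G} F-fix G-fix ι = ≋⇒≈ λ n → agree (suc n) ι n (n<1+n n)
    where
    agree : ∀ n ι → F ι ≋[< n ] G ι
    agree zero    ι m ()
    agree (suc n) ι m m<1+n i j k = ≡.trans (≈⇒≋ (F-fix ι) m i j k) (≡.trans
      (≡.cong (B ι m i j k +ℤ_) (𝕫⊗-cong-< {F = Φ F ι} {Φ G ι} (Φ-causal n {F} {G} (agree n) ι) m m<1+n i j k))
      (≡.sym (≈⇒≋ (G-fix ι) m i j k)))

-- Counting words

countᵇ : {A : Set} → (A → Bool) → List A → ℕ
countᵇ p xs = length (filterᵇ p xs)

module _ {A : Set} where

  countᵇ-++ : ∀ (p : A → Bool) xs ys → countᵇ p (xs ++ ys) ≡ countᵇ p xs + countᵇ p ys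
  countᵇ-++ p xs ys = ≡.trans (≡.cong length (filter-++ (T? ∘ p) xs ys)) (length-++ (filterᵇ p xs))

  countᵇ-cong : ∀ {p q : A → Bool} xs → (∀ x → p x ≡ q x) → countᵇ p xs ≡ countᵇ q xs
  countᵇ-cong         []       p≗q = ≡.refl
  countᵇ-cong {p} {q} (x ∷ xs) p≗q with p x | q x | p≗q x
  ... | true  | .true  | ≡.refl = ≡.cong suc (countᵇ-cong xs p≗q)
  ... | false | .false | ≡.refl = countᵇ-cong xs p≗q

  countᵇ-none : ∀ {p : A → Bool} xs → (∀ x → p x ≡ false) → countᵇ p xs ≡ 0
  countᵇ-none xs p≗false = ≡.trans (countᵇ-cong {q = λ _ → false} xs p≗false) (none xs)
    where
    none : ∀ xs → countᵇ (λ _ → false) xs ≡ 0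
    none []       = ≡.refl
    none (x ∷ xs) = none xs

  countᵇ-∨ : ∀ {p q : A → Bool} xs → (∀ x → p x ∧ q x ≡ false) →
             countᵇ (λ x → p x ∨ q x) xs ≡ countᵇ p xs + countᵇ q xs
  countᵇ-∨         []       disjoint = ≡.refl
  countᵇ-∨ {p} {q} (x ∷ xs) disjoint with p x | q x | disjoint x
  ... | true  | false | _ = ≡.cong suc (countᵇ-∨ xs disjoint)
  ... | false | true  | _ = ≡.trans (≡.cong suc (countᵇ-∨ xs disjoint)) (≡.sym (ℕ.+-suc _ _))
  ... | false | false | _ = countᵇ-∨ xs disjoint

countᵇ-map : ∀ {A B : Set} (p : B → Bool) (f : A → B) xs → countᵇ p (map f xs) ≡ countᵇ (p ∘ f) xs
countᵇ-map p f []       = ≡.refl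
countᵇ-map p f (x ∷ xs) with p (f x)
... | true  = ≡.cong suc (countᵇ-map p f xs)
... | false = countᵇ-map p f xs

countᵇ-concatMap : ∀ {A B : Set} (p : B → Bool) (f : A → List B) xs →
                   countᵇ p (concatMap f xs) ≡ sum (map (countᵇ p ∘ f) xs)
countᵇ-concatMap p f []       = ≡.refl
countᵇ-concatMap p f (x ∷ xs) =
  ≡.trans (countᵇ-++ p (f x) (concatMap f xs)) (≡.cong₂ _+_ ≡.refl (countᵇ-concatMap p f xs))

Σₛ : (Step → ℕ) → ℕ
Σₛ f = f up + (f down + (f umber + f denim))

Σₛ-cong : ∀ {f g} → (∀ s → f s ≡ g s) → Σₛ f ≡ Σₛ g
Σₛ-cong f≗g = ≡.cong₂ _+_ (f≗g up) (≡.cong₂ _+_ (f≗g down) (≡.cong₂ _+_ (f≗g umber) (f≗g denim)))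

Σₛ-+ : ∀ f g → Σₛ (λ s → f s + g s) ≡ Σₛ f + Σₛ g
Σₛ-+ f g = begin
  (f up + g up) + ((f down + g down) + ((f umber + g umber) + (f denim + g denim)))
    ≡⟨ ≡.cong (λ m → (f up + g up) + ((f down + g down) + m)) (interchange (f umber) (g umber) (f denim) (g denim)) ⟩
  (f up + g up) + ((f down + g down) + ((f umber + f denim) + (g umber + g denim)))
    ≡⟨ ≡.cong (λ m → (f up + g up) + m) (interchange (f down) (g down) (f umber + f denim) (g umber + g denim)) ⟩
  (f up + g up) + ((f down + (f umber + f denim)) + (g down + (g umber + g denim)))
    ≡⟨ interchange (f up) (g up) (f down + (f umber + f denim)) (g down + (g umber + g denim)) ⟩
  Σₛ f + Σₛ g ∎
  where
  open ≡.≡-Reasoning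
  open import Algebra.Properties.CommutativeSemigroup ℕ.+-commutativeSemigroup using (interchange)

Σₛ-comm : ∀ (f : Step → Step → ℕ) → Σₛ (λ a → Σₛ (f a)) ≡ Σₛ (λ b → Σₛ (λ a → f a b))
Σₛ-comm f = ≡.sym (≡.trans (Σₛ-+ (f up) (λ b → f down b + (f umber b + f denim b)))
  (≡.cong (λ m → Σₛ (f up) + m) (≡.trans (Σₛ-+ (f down) (λ b → f umber b + f denim b))
    (≡.cong (λ m → Σₛ (f down) + m) (Σₛ-+ (f umber) (f denim))))))

countᵇ-allWords-first : ∀ n Q → countᵇ Q (allWords (suc n)) ≡ Σₛ λ s → countᵇ (λ ps → Q (s ∷ ps)) (allWords n)
countᵇ-allWords-first n Q = begin
  countᵇ Q (allWords (suc n))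
    ≡⟨ countᵇ-concatMap Q (λ s → map (s ∷_) (allWords n)) allSteps ⟩
  sum (map (λ s → countᵇ Q (map (s ∷_) (allWords n))) allSteps)
    ≡⟨ ≡.cong sum (map-cong (λ s → countᵇ-map Q (s ∷_) (allWords n)) allSteps) ⟩
  c up + (c down + (c umber + (c denim + 0)))
    ≡⟨ ≡.cong (λ m → c up + (c down + (c umber + m))) (ℕ.+-identityʳ (c denim)) ⟩
  Σₛ c ∎
  where
  open ≡.≡-Reasoning
  c : Step → ℕ
  c s = countᵇ (λ ps → Q (s ∷ ps)) (allWords n)

-- allWords splits words by their first step; exchanging the two step sums moves the split to the last step.
countᵇ-allWords-last : ∀ n Q → countᵇ Q (allWords (suc n)) ≡ Σₛ λ s → countᵇ (λ ps → Q (ps ∷ʳ s)) (allWords n)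
countᵇ-allWords-last zero    Q = ≡.trans (countᵇ-allWords-first zero Q) (Σₛ-cong single)
  where
  single : ∀ s → countᵇ (λ ps → Q (s ∷ ps)) [ [] ] ≡ countᵇ (λ ps → Q (ps ∷ʳ s)) [ [] ]
  single s with Q [ s ]
  ... | true  = ≡.refl
  ... | false = ≡.refl
countᵇ-allWords-last (suc n) Q = begin
  countᵇ Q (allWords (suc (suc n)))
    ≡⟨ countᵇ-allWords-first (suc n) Q ⟩
  Σₛ (λ a → countᵇ (λ ps → Q (a ∷ ps)) (allWords (suc n)))
    ≡⟨ Σₛ-cong (λ a → countᵇ-allWords-last n (λ ps → Q (a ∷ ps))) ⟩
  Σₛ (λ a → Σₛ λ s → countᵇ (λ ps → Q (a ∷ ps ∷ʳ s)) (allWords n))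
    ≡⟨ Σₛ-comm (λ a s → countᵇ (λ ps → Q (a ∷ ps ∷ʳ s)) (allWords n)) ⟩
  Σₛ (λ s → Σₛ λ a → countᵇ (λ ps → Q (a ∷ ps ∷ʳ s)) (allWords n))
    ≡⟨ Σₛ-cong (λ s → countᵇ-allWords-first n (λ ps → Q (ps ∷ʳ s))) ⟨
  Σₛ (λ s → countᵇ (λ ps → Q (ps ∷ʳ s)) (allWords (suc n))) ∎
  where open ≡.≡-Reasoning

hasCounts : ℕ → ℕ → ℕ → List Step → Bool
hasCounts i j k ps = (count umber ps ≡ᵇ i) ∧ (count denim ps ≡ᵇ j) ∧ (count down ps ≡ᵇ k)

-- Modelled on genP, so that genP t is gf (isInP t) definitionally.
gf : (List Step → Bool) → Series
gf P n i j k = + countᵇ (λ ps → P ps ∧ hasCounts i j k ps) (allWords n)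

gf-cong : ∀ {P Q} → (∀ ps → P ps ≡ Q ps) → gf P ≈ gf Q
gf-cong P≗Q = ≋⇒≈ λ n i j k → ≡.cong +_ (countᵇ-cong (allWords n) λ ps → ≡.cong (_∧ _) (P≗Q ps))

gf-none : ∀ {P} → (∀ ps → P ps ≡ false) → gf P ≈ 𝟘
gf-none P≗false = ≋⇒≈ λ n i j k →
  ≡.trans (≡.cong +_ (countᵇ-none (allWords n) λ ps → ≡.cong (_∧ _) (P≗false ps))) (≡.sym (𝟘-coeff n i j k))

gf-∨ : ∀ {P Q} → (∀ ps → P ps ∧ Q ps ≡ false) → gf (λ ps → P ps ∨ Q ps) ≈ gf P ⊕ gf Q
gf-∨ {P} {Q} disjoint = ≋⇒≈ λ n i j k → ≡.cong +_ (≡.trans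
  (countᵇ-cong (allWords n) λ ps → ∧-distribʳ-∨ (hasCounts i j k ps) (P ps) (Q ps))
  (countᵇ-∨ (allWords n) λ ps → disjoint-∧ (P ps) (Q ps) _ (disjoint ps)))
  where
  disjoint-∧ : ∀ a b c → a ∧ b ≡ false → (a ∧ c) ∧ (b ∧ c) ≡ false
  disjoint-∧ true  b c a∧b≡false = ≡.trans (≡.cong (λ b → c ∧ (b ∧ c)) a∧b≡false) (∧-zeroʳ c)
  disjoint-∧ false b c _         = ≡.refl

weight : Step → Series → Series
weight up    F = F
weight down  F = 𝕒 ⊗ F
weight umber F = 𝕩 ⊗ F
weight denim F = 𝕪 ⊗ F

stepSum : (Step → Series) → Series
stepSum S = weight up (S up) ⊕ (weight down (S down) ⊕ (weight umber (S umber) ⊕ weight denim (S denim)))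

count-∷ʳ : ∀ s′ ps s → count s′ (ps ∷ʳ s) ≡ count s′ [ s ] + count s′ ps
count-∷ʳ s′ ps s = ≡.trans (countᵇ-++ (isStep s′) ps [ s ]) (ℕ.+-comm (count s′ ps) (count s′ [ s ]))

hasCounts-∷ʳ : ∀ i j k ps s → hasCounts i j k (ps ∷ʳ s) ≡
  (count umber [ s ] + count umber ps ≡ᵇ i) ∧ (count denim [ s ] + count denim ps ≡ᵇ j) ∧
  (count down [ s ] + count down ps ≡ᵇ k)
hasCounts-∷ʳ i j k ps s rewrite count-∷ʳ umber ps s | count-∷ʳ denim ps s | count-∷ʳ down ps s = ≡.refl

module _ (Q : List Step → Bool) (s : Step) (n i j k : ℕ) where

  countᵇ-∷ʳ-none : (∀ ps → hasCounts i j k (ps ∷ʳ s) ≡ false) →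
                   + countᵇ (λ ps → Q ps ∧ hasCounts i j k (ps ∷ʳ s)) (allWords n) ≡ + 0
  countᵇ-∷ʳ-none never = ≡.cong +_ (countᵇ-none (allWords n) λ ps →
    ≡.trans (≡.cong (Q ps ∧_) (never ps)) (∧-zeroʳ (Q ps)))

  countᵇ-∷ʳ-shift : ∀ i′ j′ k′ → (∀ ps → hasCounts i j k (ps ∷ʳ s) ≡ hasCounts i′ j′ k′ ps) →
                    + countᵇ (λ ps → Q ps ∧ hasCounts i j k (ps ∷ʳ s)) (allWords n) ≡ gf Q n i′ j′ k′
  countᵇ-∷ʳ-shift i′ j′ k′ same = ≡.cong +_ (countᵇ-cong (allWords n) λ ps → ≡.cong (Q ps ∧_) (same ps))

gf-∷ʳ-coeff : ∀ s Q n i j k → + countᵇ (λ ps → Q ps ∧ hasCounts i j k (ps ∷ʳ s)) (allWords n) ≡ weight s (gf Q) n i j k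
gf-∷ʳ-coeff up    Q n i       j       k       = countᵇ-∷ʳ-shift Q up n i j k i j k λ ps → hasCounts-∷ʳ i j k ps up
gf-∷ʳ-coeff down  Q n i       j       zero    = ≡.trans
  (countᵇ-∷ʳ-none Q down n i j 0 λ ps → ≡.trans (hasCounts-∷ʳ i j 0 ps down)
    (≡.trans (≡.cong ((count umber ps ≡ᵇ i) ∧_) (∧-zeroʳ (count denim ps ≡ᵇ j))) (∧-zeroʳ _)))
  (≡.sym (𝕒⊗-coeff-zero (gf Q) n i j))
gf-∷ʳ-coeff down  Q n i       j       (suc k) = ≡.trans
  (countᵇ-∷ʳ-shift Q down n i j (suc k) i j k λ ps → hasCounts-∷ʳ i j (suc k) ps down)
  (≡.sym (𝕒⊗-coeff-suc (gf Q) n i j k))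
gf-∷ʳ-coeff umber Q n zero    j       k       = ≡.trans
  (countᵇ-∷ʳ-none Q umber n 0 j k λ ps → hasCounts-∷ʳ 0 j k ps umber)
  (≡.sym (𝕩⊗-coeff-zero (gf Q) n j k))
gf-∷ʳ-coeff umber Q n (suc i) j       k       = ≡.trans
  (countᵇ-∷ʳ-shift Q umber n (suc i) j k i j k λ ps → hasCounts-∷ʳ (suc i) j k ps umber)
  (≡.sym (𝕩⊗-coeff-suc (gf Q) n i j k))
gf-∷ʳ-coeff denim Q n i       zero    k       = ≡.trans
  (countᵇ-∷ʳ-none Q denim n i 0 k λ ps → ≡.trans (hasCounts-∷ʳ i 0 k ps denim) (∧-zeroʳ _))
  (≡.sym (𝕪⊗-coeff-zero (gf Q) n i k))
gf-∷ʳ-coeff denim Q n i       (suc j) k       = ≡.trans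
  (countᵇ-∷ʳ-shift Q denim n i (suc j) k i j k λ ps → hasCounts-∷ʳ i (suc j) k ps denim)
  (≡.sym (𝕪⊗-coeff-suc (gf Q) n i j k))

gf-lastStep : ∀ P → gf P ≈ (if P [] then 𝟙 else 𝟘) ⊕ 𝕫 ⊗ stepSum (λ s → gf λ ps → P (ps ∷ʳ s))
gf-lastStep P = ≋⇒≈ coeff
  where
  S : Step → Series
  S s = gf λ ps → P (ps ∷ʳ s)

  empty : ∀ i j k → gf P 0 i j k ≡ (if P [] then 𝟙 else 𝟘) 0 i j k
  empty i j k with P []
  empty zero    zero    zero    | true  = ≡.refl
  empty zero    zero    (suc k) | true  = ≡.refl
  empty zero    (suc j) k       | true  = ≡.refl
  empty (suc i) j       k       | true  = ≡.refl
  empty i       j       k       | false = ≡.sym (𝟘-coeff 0 i j k)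

  nonempty : ∀ b n i j k → (if b then 𝟙 else 𝟘) (suc n) i j k ≡ + 0
  nonempty true  n i j k = ≡.refl
  nonempty false n i j k = ≡.refl

  coeff : gf P ≋ (if P [] then 𝟙 else 𝟘) ⊕ 𝕫 ⊗ stepSum S
  coeff zero    i j k = ≡.trans (empty i j k) (≡.trans (≡.sym (ℤ.+-identityʳ _))
    (≡.cong ((if P [] then 𝟙 else 𝟘) 0 i j k +ℤ_) (≡.sym (𝕫⊗-coeff-zero (stepSum S) i j k))))
  coeff (suc n) i j k = begin
    gf P (suc n) i j k
      ≡⟨ ≡.cong +_ (countᵇ-allWords-last n _) ⟩
    + a up +ℤ (+ a down +ℤ (+ a umber +ℤ + a denim))
      ≡⟨ ≡.cong₂ _+ℤ_ (by up) (≡.cong₂ _+ℤ_ (by down) (≡.cong₂ _+ℤ_ (by umber) (by denim))) ⟩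
    stepSum S n i j k
      ≡⟨ 𝕫⊗-coeff-suc (stepSum S) n i j k ⟨
    (𝕫 ⊗ stepSum S) (suc n) i j k
      ≡⟨ ℤ.+-identityˡ _ ⟨
    + 0 +ℤ (𝕫 ⊗ stepSum S) (suc n) i j k
      ≡⟨ ≡.cong₂ _+ℤ_ (nonempty (P []) n i j k) ≡.refl ⟨
    ((if P [] then 𝟙 else 𝟘) ⊕ 𝕫 ⊗ stepSum S) (suc n) i j k ∎
    where
    open ≡.≡-Reasoning
    a : Step → ℕ
    a s = countᵇ (λ ps → P (ps ∷ʳ s) ∧ hasCounts i j k (ps ∷ʳ s)) (allWords n)
    by : ∀ s → + a s ≡ weight s (S s) n i j k
    by s = gf-∷ʳ-coeff s (λ ps → P (ps ∷ʳ s)) n i j k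

-- Paths sorted by their final position

-- (whether a down-step has occurred, height); a path is at nothing once it has broken a rule of 𝒫.
Position : Set
Position = Bool × ℕ

step : Maybe Position → Step → Maybe Position
step nothing            _     = nothing
step (just (b , h))     up    = just (b , suc h)
step (just (b , zero))  down  = nothing
step (just (b , suc h)) down  = just (true , h)
step (just (b , zero))  umber = nothing
step (just (b , suc h)) umber = just (b , suc h)
step (just (false , h)) denim = nothing
step (just (true , h))  denim = just (true , h)

run : List Step → Maybe Position
run = foldl step (just (false , 0))

isAt : Maybe Position → Position → Bool
isAt nothing          _       = false
isAt (just (b′ , h′)) (b , h) = (h′ ≡ᵇ h) ∧ does (b′ Bool.≟ b)

endsAtHeight : ℕ → Maybe Position → Bool
endsAtHeight t σ = isAt σ (false , t) ∨ isAt σ (true , t)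

foldl-step-nothing : ∀ ps → foldl step nothing ps ≡ nothing
foldl-step-nothing []       = ≡.refl
foldl-step-nothing (s ∷ ps) = foldl-step-nothing ps

inP≡endsAtHeight : ∀ h b t ps → inP h b t ps ≡ endsAtHeight t (foldl step (just (b , h)) ps)
inP≡endsAtHeight h       b     t []           with h ≡ᵇ t | b
... | true  | true  = ≡.refl
... | true  | false = ≡.refl
... | false | true  = ≡.refl
... | false | false = ≡.refl
inP≡endsAtHeight h       b     t (up    ∷ ps) = inP≡endsAtHeight (suc h) b t ps
inP≡endsAtHeight zero    b     t (down  ∷ ps) = ≡.cong (endsAtHeight t) (≡.sym (foldl-step-nothing ps))
inP≡endsAtHeight (suc h) b     t (down  ∷ ps) = inP≡endsAtHeight h true t ps
inP≡endsAtHeight zero    b     t (umber ∷ ps) = ≡.cong (endsAtHeight t) (≡.sym (foldl-step-nothing ps))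
inP≡endsAtHeight (suc h) b     t (umber ∷ ps) = inP≡endsAtHeight (suc h) b t ps
inP≡endsAtHeight h       false t (denim ∷ ps) = ≡.cong (endsAtHeight t) (≡.sym (foldl-step-nothing ps))
inP≡endsAtHeight h       true  t (denim ∷ ps) = inP≡endsAtHeight h true t ps

isAt-disjoint : ∀ σ h → isAt σ (false , h) ∧ isAt σ (true , h) ≡ false
isAt-disjoint nothing          h = ≡.refl
isAt-disjoint (just (b′ , h′)) h with h′ ≡ᵇ h | b′
... | true  | true  = ≡.refl
... | true  | false = ≡.refl
... | false | _     = ≡.refl

-- Generic in (none, _∪_) to serve both for the Boolean test isAt and for generating functions.
module _ {A : Set} (none : A) (_∪_ : A → A → A) where

  before : Step → (Position → A) → Position → A
  before up    F (b     , zero)  = none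
  before up    F (b     , suc h) = F (b , h)
  before down  F (false , h)     = none
  before down  F (true  , h)     = F (false , suc h) ∪ F (true , suc h)
  before umber F (b     , zero)  = none
  before umber F (b     , suc h) = F (b , suc h)
  before denim F (false , h)     = none
  before denim F (true  , h)     = F (true , h)

isAt-step : ∀ σ s p → isAt (step σ s) p ≡ before false _∨_ s (isAt σ) p
isAt-step nothing              up    (b     , zero)  = ≡.refl
isAt-step nothing              up    (b     , suc h) = ≡.refl
isAt-step (just (b′ , h′))     up    (b     , zero)  = ≡.refl
isAt-step (just (b′ , h′))     up    (b     , suc h) = ≡.refl
isAt-step nothing              down  (false , h)     = ≡.refl
isAt-step nothing              down  (true  , h)     = ≡.refl
isAt-step (just (b′ , zero))   down  (false , h)     = ≡.refl
isAt-step (just (b′ , suc h′)) down  (false , h)     = ∧-zeroʳ (h′ ≡ᵇ h)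
isAt-step (just (b′ , zero))   down  (true  , h)     = ≡.refl
isAt-step (just (b′ , suc h′)) down  (true  , h)     with h′ ≡ᵇ h | b′
... | true  | true  = ≡.refl
... | true  | false = ≡.refl
... | false | _     = ≡.refl
isAt-step nothing              umber (b     , zero)  = ≡.refl
isAt-step nothing              umber (b     , suc h) = ≡.refl
isAt-step (just (b′ , zero))   umber (b     , zero)  = ≡.refl
isAt-step (just (b′ , suc h′)) umber (b     , zero)  = ≡.refl
isAt-step (just (b′ , zero))   umber (b     , suc h) = ≡.refl
isAt-step (just (b′ , suc h′)) umber (b     , suc h) = ≡.refl
isAt-step nothing              denim (false , h)     = ≡.refl
isAt-step nothing              denim (true  , h)     = ≡.refl
isAt-step (just (false , h′))  denim (false , h)     = ≡.refl
isAt-step (just (true  , h′))  denim (false , h)     = ∧-zeroʳ (h′ ≡ᵇ h)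
isAt-step (just (false , h′))  denim (true  , h)     = ≡.sym (∧-zeroʳ (h′ ≡ᵇ h))
isAt-step (just (true  , h′))  denim (true  , h)     = ≡.refl

pathGF : Position → Series
pathGF p = gf λ ps → isAt (run ps) p

genP≈pathGF : ∀ t → genP t ≈ pathGF (false , t) ⊕ pathGF (true , t)
genP≈pathGF t = trans (gf-cong {isInP t} (λ ps → inP≡endsAtHeight 0 false t ps))
  (gf-∨ {λ ps → isAt (run ps) (false , t)} {λ ps → isAt (run ps) (true , t)} λ ps → isAt-disjoint (run ps) t)

gf-before : ∀ s p → gf (λ ps → before false _∨_ s (isAt (run ps)) p) ≈ before 𝟘 _⊕_ s pathGF p
gf-before up    (b     , zero)  = gf-none λ _ → ≡.refl
gf-before up    (b     , suc h) = refl
gf-before down  (false , h)     = gf-none λ _ → ≡.refl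
gf-before down  (true  , h)     =
  gf-∨ {λ ps → isAt (run ps) (false , suc h)} {λ ps → isAt (run ps) (true , suc h)} λ ps → isAt-disjoint (run ps) (suc h)
gf-before umber (b     , zero)  = gf-none λ _ → ≡.refl
gf-before umber (b     , suc h) = refl
gf-before denim (false , h)     = gf-none λ _ → ≡.refl
gf-before denim (true  , h)     = refl

predecessorSum : (Position → Series) → Position → Series
predecessorSum F p = stepSum λ s → before 𝟘 _⊕_ s F p

atStart : Position → Series
atStart (false , zero)  = 𝟙
atStart (false , suc h) = 𝟘
atStart (true  , h)     = 𝟘

Solves : (Position → Series) → (Position → Series) → Set
Solves B F = ∀ p → F p ≈ B p ⊕ 𝕫 ⊗ predecessorSum F p

stepSum-cong : ∀ {S S′} → (∀ s → S s ≈ S′ s) → stepSum S ≈ stepSum S′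
stepSum-cong S≈S′ =
  +-cong (S≈S′ up) (+-cong (*-congˡ {𝕒} (S≈S′ down)) (+-cong (*-congˡ {𝕩} (S≈S′ umber)) (*-congˡ {𝕪} (S≈S′ denim))))

pathGF-solves : Solves atStart pathGF
pathGF-solves p = begin
  pathGF p
    ≈⟨ gf-lastStep (λ ps → isAt (run ps) p) ⟩
  (if isAt (run []) p then 𝟙 else 𝟘) ⊕ 𝕫 ⊗ stepSum (λ s → gf λ ps → isAt (run (ps ∷ʳ s)) p)
    ≈⟨ +-cong (atStart-empty p) (*-congˡ {𝕫} (stepSum-cong λ s → trans (gf-cong {λ ps → isAt (run (ps ∷ʳ s)) p} λ ps →
         ≡.trans (≡.cong (λ σ → isAt σ p) (foldl-∷ʳ step _ s ps)) (isAt-step (run ps) s p)) (gf-before s p))) ⟩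
  atStart p ⊕ 𝕫 ⊗ predecessorSum pathGF p ∎
  where
  open ≈-Reasoning
  atStart-empty : ∀ p → (if isAt (run []) p then 𝟙 else 𝟘) ≈ atStart p
  atStart-empty (false , zero)  = refl
  atStart-empty (false , suc h) = refl
  atStart-empty (true  , zero)  = refl
  atStart-empty (true  , suc h) = refl

predecessorSum-causal : ∀ n {F G : Position → Series} → (∀ p → F p ≋[< n ] G p) →
                        ∀ p → predecessorSum F p ≋[< n ] predecessorSum G p
predecessorSum-causal n {F} {G} F≋G p =
  ⊕-cong-< (before-causal up p) (⊕-cong-< (⊗-congˡ-< 𝕒 (before-causal down p))
    (⊕-cong-< (⊗-congˡ-< 𝕩 (before-causal umber p)) (⊗-congˡ-< 𝕪 (before-causal denim p))))
  where
  before-causal : ∀ s p → before 𝟘 _⊕_ s F p ≋[< n ] before 𝟘 _⊕_ s G p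
  before-causal up    (b     , zero)  = λ _ _ _ _ _ → ≡.refl
  before-causal up    (b     , suc h) = F≋G (b , h)
  before-causal down  (false , h)     = λ _ _ _ _ _ → ≡.refl
  before-causal down  (true  , h)     = ⊕-cong-< (F≋G (false , suc h)) (F≋G (true , suc h))
  before-causal umber (b     , zero)  = λ _ _ _ _ _ → ≡.refl
  before-causal umber (b     , suc h) = F≋G (b , suc h)
  before-causal denim (false , h)     = λ _ _ _ _ _ → ≡.refl
  before-causal denim (true  , h)     = F≋G (true , h)

unique-solution : ∀ {B F G} → Solves B F → Solves B G → ∀ p → F p ≈ G p
unique-solution {B} {F} {G} = unique-fixpoint predecessorSum predecessorSum-causal {B} {F} {G}

Solves-*ʳ : ∀ {B F} c → Solves B F → Solves (λ p → B p ⊗ c) (λ p → F p ⊗ c)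
Solves-*ʳ {B} {F} c F-solves p = begin
  F p ⊗ c                                ≈⟨ *-congʳ {c} (F-solves p) ⟩
  (B p ⊕ 𝕫 ⊗ predecessorSum F p) ⊗ c     ≈⟨ distribute (B p) 𝕫 (predecessorSum F p) c ⟩
  B p ⊗ c ⊕ 𝕫 ⊗ (predecessorSum F p ⊗ c) ≈⟨ +-congˡ {B p ⊗ c} (*-congˡ {𝕫} (trans
                                              (stepSum-*ʳ 𝕒 𝕩 𝕪 c (b up) (b down) (b umber) (b denim))
                                              (stepSum-cong λ s → before-*ʳ s p))) ⟩
  B p ⊗ c ⊕ 𝕫 ⊗ predecessorSum (λ q → F q ⊗ c) p ∎
  where
  open ≈-Reasoning
  b : Step → Series
  b s = before 𝟘 _⊕_ s F p
  distribute : ∀ b z e c → (b ⊕ z ⊗ e) ⊗ c ≈ b ⊗ c ⊕ z ⊗ (e ⊗ c)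
  distribute = solve 4 (λ b z e c → (b :+ z :* e) :* c := b :* c :+ z :* (e :* c)) refl
  stepSum-*ʳ : ∀ α x y c u d m n →
               (u ⊕ (α ⊗ d ⊕ (x ⊗ m ⊕ y ⊗ n))) ⊗ c ≈ u ⊗ c ⊕ (α ⊗ (d ⊗ c) ⊕ (x ⊗ (m ⊗ c) ⊕ y ⊗ (n ⊗ c)))
  stepSum-*ʳ = solve 8 (λ α x y c u d m n →
    (u :+ (α :* d :+ (x :* m :+ y :* n))) :* c := u :* c :+ (α :* (d :* c) :+ (x :* (m :* c) :+ y :* (n :* c)))) refl
  before-*ʳ : ∀ s p → before 𝟘 _⊕_ s F p ⊗ c ≈ before 𝟘 _⊕_ s (λ q → F q ⊗ c) p
  before-*ʳ up    (b     , zero)  = zeroˡ c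
  before-*ʳ up    (b     , suc h) = refl
  before-*ʳ down  (false , h)     = zeroˡ c
  before-*ʳ down  (true  , h)     = distribʳ c (F (false , suc h)) (F (true , suc h))
  before-*ʳ umber (b     , zero)  = zeroˡ c
  before-*ʳ umber (b     , suc h) = refl
  before-*ʳ denim (false , h)     = zeroˡ c
  before-*ʳ denim (true  , h)     = refl

-- The closed forms

module ClosedFormSyntax {n} (z x y α W g : Polynomial n) where

  𝟎 𝟏 d₁ d₂ d₃ rW rg r₃ : Polynomial n
  𝟎  = con (+ 0)
  𝟏  = con (+ 1)
  d₁ = 𝟏 :+ y :* W
  d₂ = 𝟏 :+ x :* W
  d₃ = y :+ α :* W
  rW = W :- z :* (𝟏 :+ (x :+ y) :* W :+ α :* (W :* W))
  rg = g :- z :* (𝟏 :+ x :* g)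
  r₃ = W :- g :* (𝟏 :+ y :* W :+ α :* (W :* W))

  cf : Polynomial n → Polynomial n
  cf G = G :* d₁ :* d₂ :* d₃

  ct : Polynomial n → Polynomial n → Polynomial n → Polynomial n
  ct Q P G = α :* Q :* d₃ :+ α :* W :* (P :- G) :* d₂

module ClosedForm (W g : Series)
                  (W-eq : W ≈ 𝕫 ⊗ (𝟙 ⊕ (𝕩 ⊕ 𝕪) ⊗ W ⊕ 𝕒 ⊗ (W ⊗ W)))
                  (g-eq : g ≈ 𝕫 ⊗ (𝟙 ⊕ 𝕩 ⊗ g)) where

  D₁ D₂ D₃ : Series
  D₁ = 𝟙 ⊕ 𝕪 ⊗ W
  D₂ = 𝟙 ⊕ 𝕩 ⊗ W
  D₃ = 𝕪 ⊕ 𝕒 ⊗ W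

  -- Both sides are fixed points of F ↦ z (1 + yW + αW² + xF).
  W≈g[1+yW+αW²] : W ≈ g ⊗ (𝟙 ⊕ 𝕪 ⊗ W ⊕ 𝕒 ⊗ (W ⊗ W))
  W≈g[1+yW+αW²] = unique-fixpoint Φ Φ-causal {λ _ → 𝟘} {λ _ → W} {λ _ → g ⊗ c} (λ _ → W-fixed) (λ _ → gc-fixed) tt
    where
    c : Series
    c = 𝟙 ⊕ 𝕪 ⊗ W ⊕ 𝕒 ⊗ (W ⊗ W)
    Φ : (⊤ → Series) → ⊤ → Series
    Φ F _ = c ⊕ 𝕩 ⊗ F tt
    Φ-causal : ∀ n {F G : ⊤ → Series} → (∀ ι → F ι ≋[< n ] G ι) → ∀ ι → Φ F ι ≋[< n ] Φ G ι
    Φ-causal n F≋G _ = ⊕-cong-< {F = c} {c} (λ _ _ _ _ _ → ≡.refl) (⊗-congˡ-< 𝕩 (F≋G tt))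
    W-fixed : W ≈ 𝟘 ⊕ 𝕫 ⊗ (c ⊕ 𝕩 ⊗ W)
    W-fixed = trans W-eq (solve 5 (λ z x y α W →
      z :* (con (+ 1) :+ (x :+ y) :* W :+ α :* (W :* W))
        := con (+ 0) :+ z :* (con (+ 1) :+ y :* W :+ α :* (W :* W) :+ x :* W)) refl 𝕫 𝕩 𝕪 𝕒 W)
    gc-fixed : g ⊗ c ≈ 𝟘 ⊕ 𝕫 ⊗ (c ⊕ 𝕩 ⊗ (g ⊗ c))
    gc-fixed = trans (*-congʳ {c} g-eq) (solve 4 (λ z x g c →
      z :* (con (+ 1) :+ x :* g) :* c := con (+ 0) :+ z :* (c :+ x :* (g :* c))) refl 𝕫 𝕩 g c)

  ρW ρg ρ₃ : Series
  ρW = W ⊖ 𝕫 ⊗ (𝟙 ⊕ (𝕩 ⊕ 𝕪) ⊗ W ⊕ 𝕒 ⊗ (W ⊗ W))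
  ρg = g ⊖ 𝕫 ⊗ (𝟙 ⊕ 𝕩 ⊗ g)
  ρ₃ = W ⊖ g ⊗ (𝟙 ⊕ 𝕪 ⊗ W ⊕ 𝕒 ⊗ (W ⊗ W))

  modulo-relations : ∀ {L R} a b c → L ≈ R ⊕ (a ⊗ ρW ⊕ b ⊗ ρg ⊕ c ⊗ ρ₃) → L ≈ R
  modulo-relations {L} {R} a b c L≈R+ρ = begin
    L                               ≈⟨ L≈R+ρ ⟩
    R ⊕ (a ⊗ ρW ⊕ b ⊗ ρg ⊕ c ⊗ ρ₃) ≈⟨ +-congˡ {R} (+-cong (+-cong (*-congˡ {a} (x≈y⇒x∙y⁻¹≈ε W-eq))
                                         (*-congˡ {b} (x≈y⇒x∙y⁻¹≈ε g-eq))) (*-congˡ {c} (x≈y⇒x∙y⁻¹≈ε W≈g[1+yW+αW²]))) ⟩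
    R ⊕ (a ⊗ 𝟘 ⊕ b ⊗ 𝟘 ⊕ c ⊗ 𝟘)    ≈⟨ solve 4 (λ R a b c →
                                         R :+ (a :* con (+ 0) :+ b :* con (+ 0) :+ c :* con (+ 0)) := R) refl R a b c ⟩
    R                               ∎
    where
    open ≈-Reasoning
    open import Algebra.Properties.Group (CommutativeRing.+-group seriesRing) using (x≈y⇒x∙y⁻¹≈ε)

  -- D₁ D₂ D₃ times the generating function of the paths ending at the given position.
  closedForm : Position → Series
  closedForm (false , h) = g ^^ h ⊗ D₁ ⊗ D₂ ⊗ D₃
  closedForm (true  , h) = 𝕒 ⊗ (W ^^ (h + 2)) ⊗ D₃ ⊕ 𝕒 ⊗ W ⊗ ((W ^^ h) ⊖ (g ^^ h)) ⊗ D₂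

  -- In each case the arguments of modulo-relations are the cofactors of ρW, ρg and ρ₃ that make
  -- the equation a polynomial identity.
  closedForm-solves : Solves (λ p → atStart p ⊗ (D₁ ⊗ D₂ ⊗ D₃)) closedForm
  closedForm-solves (false , zero) = solve 6 (λ z x y α W g → let open ClosedFormSyntax z x y α W g in
      cf 𝟏 := 𝟏 :* (d₁ :* d₂ :* d₃) :+ z :* (𝟎 :+ (α :* 𝟎 :+ (x :* 𝟎 :+ y :* 𝟎))))
    refl 𝕫 𝕩 𝕪 𝕒 W g
  closedForm-solves (false , suc h) = modulo-relations 𝟘 (g ^^ h ⊗ (D₁ ⊗ D₂ ⊗ D₃)) 𝟘
    (solve 7 (λ z x y α W g G → let open ClosedFormSyntax z x y α W g in
      cf (g :* G)
        := 𝟎 :* (d₁ :* d₂ :* d₃) :+ z :* (cf G :+ (α :* 𝟎 :+ (x :* cf (g :* G) :+ y :* 𝟎)))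
           :+ (𝟎 :* rW :+ G :* (d₁ :* d₂ :* d₃) :* rg :+ 𝟎 :* r₃))
    refl 𝕫 𝕩 𝕪 𝕒 W g (g ^^ h))
  closedForm-solves (true , zero) = modulo-relations (𝕒 ⊗ W ⊗ D₃) 𝟘 (𝕒 ⊗ 𝕪 ⊗ 𝕫 ⊗ D₂)
    (solve 6 (λ z x y α W g → let open ClosedFormSyntax z x y α W g in
      ct (W :* (W :* 𝟏)) 𝟏 𝟏
        := 𝟎 :* (d₁ :* d₂ :* d₃)
           :+ z :* (𝟎 :+ (α :* (cf (g :* 𝟏) :+ ct (W :* (W :* (W :* 𝟏))) (W :* 𝟏) (g :* 𝟏))
                          :+ (x :* 𝟎 :+ y :* ct (W :* (W :* 𝟏)) 𝟏 𝟏)))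
           :+ (α :* W :* d₃ :* rW :+ 𝟎 :* rg :+ α :* y :* z :* d₂ :* r₃))
    refl 𝕫 𝕩 𝕪 𝕒 W g)
  closedForm-solves (true , suc h) =
    modulo-relations (𝕒 ⊗ (W ^^ (h + 2) ⊗ D₃ ⊕ W ⊗ W ^^ h ⊗ D₂))
                     (⊝ (𝕒 ⊗ W ⊗ D₂ ⊗ g ^^ h))
                     (𝕒 ⊗ 𝕪 ⊗ 𝕫 ⊗ g ⊗ D₂ ⊗ g ^^ h)
    (solve 9 (λ z x y α W g Q P G → let open ClosedFormSyntax z x y α W g in
      ct (W :* Q) (W :* P) (g :* G)
        := 𝟎 :* (d₁ :* d₂ :* d₃)
           :+ z :* (ct Q P G :+ (α :* (cf (g :* (g :* G)) :+ ct (W :* (W :* Q)) (W :* (W :* P)) (g :* (g :* G)))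
                                 :+ (x :* ct (W :* Q) (W :* P) (g :* G) :+ y :* ct (W :* Q) (W :* P) (g :* G))))
           :+ (α :* (Q :* d₃ :+ W :* P :* d₂) :* rW :+ :- (α :* W :* d₂ :* G) :* rg :+ α :* y :* z :* g :* d₂ :* G :* r₃))
    refl 𝕫 𝕩 𝕪 𝕒 W g (W ^^ (h + 2)) (W ^^ h) (g ^^ h))

z/1-xz-eq : z/1-xz ≈ 𝕫 ⊗ (𝟙 ⊕ 𝕩 ⊗ z/1-xz)
z/1-xz-eq = ≋⇒≈ coeff
  where
  coeff : z/1-xz ≋ 𝕫 ⊗ (𝟙 ⊕ 𝕩 ⊗ z/1-xz)
  coeff zero    i j k = ≡.sym (𝕫⊗-coeff-zero (𝟙 ⊕ 𝕩 ⊗ z/1-xz) i j k)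
  coeff (suc n) i j k = ≡.trans (shift n i) (≡.sym (𝕫⊗-coeff-suc (𝟙 ⊕ 𝕩 ⊗ z/1-xz) n i j k))
    where
    shift : ∀ n i → z/1-xz (suc n) i j k ≡ 𝟙 n i j k +ℤ (𝕩 ⊗ z/1-xz) n i j k
    shift zero    zero    = ≡.trans (≡.sym (ℤ.+-identityʳ _)) (≡.cong (𝟙 0 0 j k +ℤ_) (≡.sym (𝕩⊗-coeff-zero z/1-xz 0 j k)))
    shift (suc n) zero    = ≡.sym (≡.cong (𝟙 (suc n) 0 j k +ℤ_) (𝕩⊗-coeff-zero z/1-xz (suc n) j k))
    shift zero    (suc i) = ≡.sym (≡.cong (𝟙 0 (suc i) j k +ℤ_) (𝕩⊗-coeff-suc z/1-xz 0 i j k))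
    shift (suc n) (suc i) = ≡.sym (≡.trans (≡.cong (𝟙 (suc n) (suc i) j k +ℤ_) (𝕩⊗-coeff-suc z/1-xz (suc n) i j k))
                                           (ℤ.+-identityˡ _))

zM-eq : ∀ M → M ≋ 𝟙 ⊕ (𝕩 ⊕ 𝕪) ⊗ 𝕫 ⊗ M ⊕ 𝕒 ⊗ (𝕫 ^^ 2) ⊗ (M ^^ 2) →
        𝕫 ⊗ M ≈ 𝕫 ⊗ (𝟙 ⊕ (𝕩 ⊕ 𝕪) ⊗ (𝕫 ⊗ M) ⊕ 𝕒 ⊗ ((𝕫 ⊗ M) ⊗ (𝕫 ⊗ M)))
zM-eq M M-eq = trans (*-congˡ {𝕫} (≋⇒≈ M-eq)) (solve 5 (λ z x y α M →
  z :* (con (+ 1) :+ (x :+ y) :* z :* M :+ α :* (z :* (z :* con (+ 1))) :* (M :* (M :* con (+ 1))))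
    := z :* (con (+ 1) :+ (x :+ y) :* (z :* M) :+ α :* ((z :* M) :* (z :* M)))) refl 𝕫 𝕩 𝕪 𝕒 M)

proposition9 : (t : ℕ) (M : Series) →
    M ≋ 𝟙 ⊕ (𝕩 ⊕ 𝕪) ⊗ 𝕫 ⊗ M ⊕ 𝕒 ⊗ (𝕫 ^^ 2) ⊗ (M ^^ 2) →
    genP t ⊗ (𝟙 ⊕ 𝕪 ⊗ (𝕫 ⊗ M)) ⊗ (𝟙 ⊕ 𝕩 ⊗ (𝕫 ⊗ M)) ⊗ (𝕪 ⊕ 𝕒 ⊗ (𝕫 ⊗ M))
    ≋ (z/1-xz ^^ t) ⊗ (𝟙 ⊕ 𝕪 ⊗ (𝕫 ⊗ M)) ⊗ (𝟙 ⊕ 𝕩 ⊗ (𝕫 ⊗ M)) ⊗ (𝕪 ⊕ 𝕒 ⊗ (𝕫 ⊗ M))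
    ⊕ 𝕒 ⊗ ((𝕫 ⊗ M) ^^ (t + 2)) ⊗ (𝕪 ⊕ 𝕒 ⊗ (𝕫 ⊗ M))
    ⊕ 𝕒 ⊗ (𝕫 ⊗ M) ⊗ (((𝕫 ⊗ M) ^^ t) ⊖ (z/1-xz ^^ t)) ⊗ (𝟙 ⊕ 𝕩 ⊗ (𝕫 ⊗ M))
proposition9 t M M-eq = ≈⇒≋ (begin
  genP t ⊗ D₁ ⊗ D₂ ⊗ D₃
    ≈⟨ *-congʳ {D₃} (*-congʳ {D₂} (*-congʳ {D₁} (genP≈pathGF t))) ⟩
  (pathGF (false , t) ⊕ pathGF (true , t)) ⊗ D₁ ⊗ D₂ ⊗ D₃
    ≈⟨ solve 5 (λ a b d₁ d₂ d₃ → (a :+ b) :* d₁ :* d₂ :* d₃ := a :* (d₁ :* d₂ :* d₃) :+ b :* (d₁ :* d₂ :* d₃))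
         refl (pathGF (false , t)) (pathGF (true , t)) D₁ D₂ D₃ ⟩
  pathGF (false , t) ⊗ (D₁ ⊗ D₂ ⊗ D₃) ⊕ pathGF (true , t) ⊗ (D₁ ⊗ D₂ ⊗ D₃)
    ≈⟨ +-cong (scaled≈closedForm (false , t)) (scaled≈closedForm (true , t)) ⟩
  closedForm (false , t) ⊕ closedForm (true , t)
    ≈⟨ +-assoc (closedForm (false , t)) _ _ ⟨
  _ ∎)
  where
  open ≈-Reasoning
  open ClosedForm (𝕫 ⊗ M) z/1-xz (zM-eq M M-eq) z/1-xz-eq
  scaled≈closedForm : ∀ p → pathGF p ⊗ (D₁ ⊗ D₂ ⊗ D₃) ≈ closedForm p
  scaled≈closedForm = unique-solution {λ p → atStart p ⊗ (D₁ ⊗ D₂ ⊗ D₃)} {λ p → pathGF p ⊗ (D₁ ⊗ D₂ ⊗ D₃)}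
    (Solves-*ʳ {atStart} {pathGF} (D₁ ⊗ D₂ ⊗ D₃) pathGF-solves) closedForm-solves
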